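{- Let $q$ be a prime power, let $n,k$ be integers with $1<k<n-1$, and let $V=\mathbb{F}_q^n$. Then the graph $\Gamma(n,k)_q$ (the restriction of the Grassmann graph $\Gamma_k(V)$ to the set $\mathcal{C}(n,k)_q$ of non-degenerate linear $[n,k]_q$ codes) is connected.
   Context: $\mathbb{F}_q$ is the finite field with $q$ elements. For $i=1,\dots,n$, let $C_i=\{(x_1,\dots,x_n)\in V: x_i=0\}$ be the kernel of the $i$-th coordinate functional. A non-degenerate linear $[n,k]_q$ code is a $k$-dimensional subspace of $V$ not contained in any $C_i$; $\mathcal{C}(n,k)_q$ denotes the set of all such codes. The Grassmann graph $\Gamma_k(V)$ has as vertices all $k$-dimensional subspaces of $V$, two being adjacent iff their intersection is $(k-1)$-dimensional. $\Gamma(n,k)_q$ is the induced subgraph of $\Gamma_k(V)$ on the vertex set $\mathcal{C}(n,k)_q$. -}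

module Defs where

open import Level using (Level; _⊔_)
open import Data.Nat using (ℕ; zero; suc; _<_; _^_; _∸_)
open import Data.Nat.Primality using (Prime)
open import Data.Fin using (Fin) renaming (zero to fzero; suc to fsuc)
open import Data.Product using (Σ; ∃; _×_; _,_)
open import Relation.Nullary using (¬_; Dec)
open import Relation.Binary.PropositionalEquality using (_≡_)
open import Algebra.Bundles using (CommutativeRing)

IsPrimePower : ℕ → Set
IsPrimePower q = Σ ℕ λ p → Σ ℕ λ m → Prime p × (0 < m) × (q ≡ p ^ m)

record FiniteField (c ℓ : Level) (q : ℕ) : Set (Level.suc (c ⊔ ℓ)) where
  field
    commutativeRing : CommutativeRing c ℓ
  open CommutativeRing commutativeRing public
  field
    0≉1      : ¬ (0# ≈ 1#)
    inverse  : ∀ x → ¬ (x ≈ 0#) → Σ Carrier λ y → (x * y) ≈ 1#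
    _≟_      : ∀ x y → Dec (x ≈ y)
    enum     : Fin q → Carrier
    enum-inj : ∀ i j → enum i ≈ enum j → i ≡ j
    enum-sur : ∀ x → Σ (Fin q) λ i → enum i ≈ x

module Linear {c ℓ : Level} {q : ℕ} (F : FiniteField c ℓ q) where
  open FiniteField F

  Vec : ℕ → Set c
  Vec n = Fin n → Carrier

  _≈ᵥ_ : ∀ {n} → Vec n → Vec n → Set ℓ
  u ≈ᵥ v = ∀ i → u i ≈ v i

  0ᵥ : ∀ {n} → Vec n
  0ᵥ _ = 0#

  lincomb : ∀ {n} k → (Fin k → Carrier) → (Fin k → Vec n) → Vec n
  lincomb zero    a B i = 0#
  lincomb (suc k) a B i = (a fzero * B fzero i) + lincomb k (λ j → a (fsuc j)) (λ j → B (fsuc j)) i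

  _∈Span_ : ∀ {n k} → Vec n → (Fin k → Vec n) → Set (c ⊔ ℓ)
  _∈Span_ {k = k} v B = Σ (Fin k → Carrier) λ a → v ≈ᵥ lincomb k a B

  LinIndep : ∀ {n k} → (Fin k → Vec n) → Set (c ⊔ ℓ)
  LinIndep {k = k} B = ∀ a → lincomb k a B ≈ᵥ 0ᵥ → ∀ j → a j ≈ 0#

  HasDim : ∀ {n} → ℕ → (Vec n → Set (c ⊔ ℓ)) → Set (c ⊔ ℓ)
  HasDim {n} d W =
    Σ (Fin d → Vec n) λ D →
      (∀ j → W (D j)) × LinIndep D × (∀ v → W v → v ∈Span D)

  -- a k-dimensional subspace of V = F^n, given by a basis (generator matrix);
  -- the subspace itself is the span of the basis
  record Subspace (n k : ℕ) : Set (c ⊔ ℓ) where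
    field
      basis  : Fin k → Vec n
      indep  : LinIndep basis

  open Subspace public

  _∈_ : ∀ {n k} → Vec n → Subspace n k → Set (c ⊔ ℓ)
  v ∈ U = v ∈Span basis U

  ⊆C : ∀ {n k} → Subspace n k → Fin n → Set (c ⊔ ℓ)
  ⊆C U i = ∀ v → v ∈ U → v i ≈ 0#

  NonDegenerate : ∀ {n k} → Subspace n k → Set (c ⊔ ℓ)
  NonDegenerate {n} U = ∀ (i : Fin n) → ¬ ⊆C U i

  record Code (n k : ℕ) : Set (c ⊔ ℓ) where
    field
      space  : Subspace n k
      nondeg : NonDegenerate space

  open Code public

  Adjacent : ∀ {n k} → Subspace n k → Subspace n k → Set (c ⊔ ℓ)
  Adjacent {k = k} U W = HasDim (k ∸ 1) (λ v → v ∈ U × v ∈ W)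

-- Fix the hub code H spanned by the all-ones vector 𝟙 and the unit vectors
-- e₂, …, e_k; a code containing 𝟙 is non-degenerate.  From any code, a
-- Steinitz exchange walks towards H: while the current basis starts with the
-- first m hub vectors, the next hub vector either lies outside the current
-- code, and putting it in place of the next basis vector moves to an
-- adjacent code (still containing 𝟙), or lies inside it, and an exchange
-- followed by a transposition changes the basis but not the code.  The walk
-- ends at a code with the same span as H, which need not be H itself as a
-- vertex (its basis may differ); it is joined to H through the code N
-- obtained from H by replacing e₂ by e₀.  N is adjacent to both because
-- e₀ ∉ H: every vector of H takes equal values at the coordinates 0 and 1.

module Submission where

open import Defs
open import Level using (Level; _⊔_)
open import Data.Nat as ℕ using (ℕ; zero; suc; _<_; _≤_; _∸_; z≤n; s≤s)
import Data.Nat.Properties as ℕ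
open import Data.Fin as Fin using (Fin; zero; suc; toℕ; inject₁; fromℕ; fromℕ<; inject≤; punchIn)
import Data.Fin.Properties as Fin
open import Data.Fin.Permutation as Perm using (Permutation′; _⟨$⟩ʳ_; _⟨$⟩ˡ_)
import Data.Fin.Permutation.Components as PC
open import Data.Vec.Functional using (_∷_; removeAt; insertAt; updateAt)
open import Data.Vec.Functional.Properties
  using (updateAt-updates; updateAt-minimal; insertAt-lookup; insertAt-punchIn)
open import Data.Product using (Σ; ∃; _×_; _,_; proj₂)
open import Data.Empty using (⊥-elim)
open import Function using (_∘_; const)
open import Relation.Nullary using (¬_; Dec; yes; no)
open import Relation.Nullary.Decidable using (_×-dec_; ¬?; dec-true; dec-false)
open import Relation.Binary.PropositionalEquality as ≡ using (_≡_; _≢_; _≗_)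
open import Relation.Binary.Construct.Closure.ReflexiveTransitive
  using (Star; ε; _◅_; _◅◅_; reverse)

_[_]≔_ : ∀ {a} {A : Set a} {k} → (Fin k → A) → Fin k → A → Fin k → A
B [ p ]≔ w = updateAt B p (const w)

[]≔-updates : ∀ {a} {A : Set a} {k} (B : Fin k → A) p {w} → (B [ p ]≔ w) p ≡ w
[]≔-updates B p = updateAt-updates p B

[]≔-minimal : ∀ {a} {A : Set a} {k} (B : Fin k → A) {p i w} → i ≢ p → (B [ p ]≔ w) i ≡ B i
[]≔-minimal B {p} {i} = updateAt-minimal i p B

transpose-matchˡ : ∀ {k} (i j : Fin k) → PC.transpose i j i ≡ j
transpose-matchˡ i j rewrite dec-true (i Fin.≟ i) ≡.refl = ≡.refl

transpose-fixes : ∀ {k} {i j l : Fin k} → l ≢ i → l ≢ j → PC.transpose i j l ≡ l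
transpose-fixes {i = i} {j} {l} l≢i l≢j
  rewrite dec-false (l Fin.≟ i) l≢i | dec-false (l Fin.≟ j) l≢j = ≡.refl

Path : ∀ {a r} {A : Set a} → (A → A → Set r) → A → A → Set (a ⊔ r)
Path {A = A} R x y =
  Σ ℕ λ m → Σ (Fin (suc m) → A) λ P →
    (P zero ≡ x) × (P (fromℕ m) ≡ y) × (∀ (i : Fin m) → R (P (inject₁ i)) (P (suc i)))

fromStar : ∀ {a r} {A : Set a} {R : A → A → Set r} {x y} → Star R x y → Path R x y
fromStar {x = x} ε = 0 , const x , ≡.refl , ≡.refl , λ ()
fromStar {x = x} (r ◅ rs) with fromStar rs
... | m , P , ≡.refl , P-end , steps =
  suc m , x ∷ P , ≡.refl , P-end , λ { zero → r ; (suc i) → steps i }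

module LinearAlgebra {c ℓ : Level} {q : ℕ} (F : FiniteField c ℓ q) {n : ℕ} where
  open FiniteField F hiding (zero)
  open Linear F
  open import Algebra.Properties.Ring ring
    using (-1*x≈-x; //-rightDividesˡ; //-rightDividesʳ; x∙y⁻¹≈ε⇒x≈y; x≈y⇒x∙y⁻¹≈ε)
  open import Algebra.Properties.Semiring.Sum semiring
    using ( sum; sum-cong-≋; sum-cong-≗; sum-replicate-zero; sum-remove; ∑-distrib-+
          ; *-distribˡ-sum; sum-permute )
  open import Relation.Binary.Reasoning.Setoid setoid

  V : Set c
  V = Vec n

  1≉0 : ¬ 1# ≈ 0#
  1≉0 = 0≉1 ∘ sym

  x-y≈z⇒x≈y+z : ∀ {x y z} → x + - y ≈ z → x ≈ y + z
  x-y≈z⇒x≈y+z {x} {y} {z} x-y≈z =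
    trans (sym (//-rightDividesˡ y x)) (trans (+-congʳ x-y≈z) (+-comm z y))

  x≈y+z⇒x-y≈z : ∀ {x y z} → x ≈ y + z → x + - y ≈ z
  x≈y+z⇒x-y≈z {x} {y} {z} x≈y+z = trans (+-congʳ (trans x≈y+z (+-comm y z))) (//-rightDividesʳ y z)

  isolate : ∀ {x y u w r} → x * y ≈ 1# → u ≈ x * w + r → w ≈ y * (u + - 1# * r)
  isolate {x} {y} {u} {w} {r} xy≈1 u≈xw+r = sym (begin
    y * (u + - 1# * r)       ≈⟨ *-congˡ (+-congˡ (-1*x≈-x r)) ⟩
    y * (u + - r)            ≈⟨ *-congˡ (+-congʳ u≈xw+r) ⟩
    y * ((x * w + r) + - r)  ≈⟨ *-congˡ (//-rightDividesʳ r (x * w)) ⟩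
    y * (x * w)              ≈⟨ *-assoc y x w ⟨
    (y * x) * w              ≈⟨ *-congʳ (trans (*-comm y x) xy≈1) ⟩
    1# * w                   ≈⟨ *-identityˡ w ⟩
    w                        ∎)

  lincomb≡sum : ∀ k (a : Fin k → Carrier) (B : Fin k → V) i → lincomb k a B i ≡ sum (λ j → a j * B j i)
  lincomb≡sum zero    a B i = ≡.refl
  lincomb≡sum (suc k) a B i = ≡.cong (a zero * B zero i +_) (lincomb≡sum k (a ∘ suc) (B ∘ suc) i)

  lincomb-cong : ∀ k {a a′ : Fin k → Carrier} {B B′ : Fin k → V} i →
                 (∀ j → a j * B j i ≈ a′ j * B′ j i) → lincomb k a B i ≈ lincomb k a′ B′ i
  lincomb-cong k {a} {a′} {B} {B′} i terms≈ = begin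
    lincomb k a B i            ≡⟨ lincomb≡sum k a B i ⟩
    sum (λ j → a j * B j i)    ≈⟨ sum-cong-≋ {k} terms≈ ⟩
    sum (λ j → a′ j * B′ j i)  ≡⟨ lincomb≡sum k a′ B′ i ⟨
    lincomb k a′ B′ i          ∎

  lincomb-zero : ∀ k {a : Fin k → Carrier} {B : Fin k → V} i →
                 (∀ j → a j * B j i ≈ 0#) → lincomb k a B i ≈ 0#
  lincomb-zero k {a} {B} i terms≈0 = begin
    lincomb k a B i          ≡⟨ lincomb≡sum k a B i ⟩
    sum (λ j → a j * B j i)  ≈⟨ sum-cong-≋ {k} terms≈0 ⟩
    sum {k} (const 0#)       ≈⟨ sum-replicate-zero k ⟩
    0#                       ∎

  lincomb-+ : ∀ k (a b : Fin k → Carrier) (B : Fin k → V) i →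
              lincomb k (λ j → a j + b j) B i ≈ lincomb k a B i + lincomb k b B i
  lincomb-+ k a b B i = begin
    lincomb k (λ j → a j + b j) B i
      ≡⟨ lincomb≡sum k _ B i ⟩
    sum (λ j → (a j + b j) * B j i)
      ≈⟨ sum-cong-≋ {k} (λ j → distribʳ (B j i) (a j) (b j)) ⟩
    sum (λ j → a j * B j i + b j * B j i)
      ≈⟨ ∑-distrib-+ {k} _ _ ⟩
    sum (λ j → a j * B j i) + sum (λ j → b j * B j i)
      ≡⟨ ≡.cong₂ _+_ (lincomb≡sum k a B i) (lincomb≡sum k b B i) ⟨
    lincomb k a B i + lincomb k b B i
      ∎

  lincomb-* : ∀ k x (a : Fin k → Carrier) (B : Fin k → V) i →
              lincomb k (λ j → x * a j) B i ≈ x * lincomb k a B i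
  lincomb-* k x a B i = begin
    lincomb k (λ j → x * a j) B i  ≡⟨ lincomb≡sum k _ B i ⟩
    sum (λ j → (x * a j) * B j i)  ≈⟨ sum-cong-≋ {k} (λ j → *-assoc x (a j) (B j i)) ⟩
    sum (λ j → x * (a j * B j i))  ≈⟨ *-distribˡ-sum {k} x _ ⟨
    x * sum (λ j → a j * B j i)    ≡⟨ ≡.cong (x *_) (lincomb≡sum k a B i) ⟨
    x * lincomb k a B i            ∎

  lincomb-removeAt : ∀ k (a : Fin (suc k) → Carrier) (B : Fin (suc k) → V) p i →
                     lincomb (suc k) a B i ≈ a p * B p i + lincomb k (removeAt a p) (removeAt B p) i
  lincomb-removeAt k a B p i = begin
    lincomb (suc k) a B i
      ≡⟨ lincomb≡sum (suc k) a B i ⟩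
    sum (λ j → a j * B j i)
      ≈⟨ sum-remove {k} {p} (λ j → a j * B j i) ⟩
    a p * B p i + sum (λ j → a (punchIn p j) * B (punchIn p j) i)
      ≡⟨ ≡.cong (a p * B p i +_) (lincomb≡sum k (removeAt a p) (removeAt B p) i) ⟨
    a p * B p i + lincomb k (removeAt a p) (removeAt B p) i
      ∎

  lincomb-permute : ∀ k (a : Fin k → Carrier) (B : Fin k → V) (π : Permutation′ k) i →
                    lincomb k a (B ∘ (π ⟨$⟩ʳ_)) i ≈ lincomb k (a ∘ (π ⟨$⟩ˡ_)) B i
  lincomb-permute k a B π i = begin
    lincomb k a (B ∘ (π ⟨$⟩ʳ_)) i
      ≡⟨ lincomb≡sum k a _ i ⟩
    sum (λ j → a j * B (π ⟨$⟩ʳ j) i)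
      ≡⟨ sum-cong-≗ (λ j → ≡.cong (λ l → a l * B (π ⟨$⟩ʳ j) i) (Perm.inverseˡ π)) ⟨
    sum (λ j → a (π ⟨$⟩ˡ (π ⟨$⟩ʳ j)) * B (π ⟨$⟩ʳ j) i)
      ≈⟨ sum-permute (λ j → a (π ⟨$⟩ˡ j) * B j i) π ⟨
    sum (λ j → a (π ⟨$⟩ˡ j) * B j i)
      ≡⟨ lincomb≡sum k _ B i ⟨
    lincomb k (a ∘ (π ⟨$⟩ˡ_)) B i
      ∎

  δ : ∀ {k} → Fin k → Fin k → Carrier
  δ p = const 0# [ p ]≔ 1#

  δ-diagonal : ∀ {k} (p : Fin k) → δ p p ≡ 1#
  δ-diagonal p = []≔-updates (const 0#) p

  δ-offDiagonal : ∀ {k} {p i : Fin k} → i ≢ p → δ p i ≡ 0#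
  δ-offDiagonal = []≔-minimal (const 0#)

  lincomb-δ : ∀ k (B : Fin (suc k) → V) p i → lincomb (suc k) (δ p) B i ≈ B p i
  lincomb-δ k B p i = begin
    lincomb (suc k) (δ p) B i
      ≈⟨ lincomb-removeAt k (δ p) B p i ⟩
    δ p p * B p i + lincomb k (removeAt (δ p) p) (removeAt B p) i
      ≈⟨ +-cong (*-congʳ (reflexive (δ-diagonal p))) others≈0 ⟩
    1# * B p i + 0#
      ≈⟨ +-identityʳ _ ⟩
    1# * B p i
      ≈⟨ *-identityˡ _ ⟩
    B p i
      ∎
    where
    others≈0 : lincomb k (removeAt (δ p) p) (removeAt B p) i ≈ 0#
    others≈0 = lincomb-zero k i λ j →
      trans (*-congʳ (reflexive (δ-offDiagonal (Fin.punchInᵢ≢i p j)))) (zeroˡ _)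

  lincomb-insertAt : ∀ k (a : Fin k → Carrier) (B : Fin (suc k) → V) p i →
                     lincomb (suc k) (insertAt a p 0#) B i ≈ lincomb k a (removeAt B p) i
  lincomb-insertAt k a B p i = begin
    lincomb (suc k) (insertAt a p 0#) B i
      ≈⟨ lincomb-removeAt k (insertAt a p 0#) B p i ⟩
    insertAt a p 0# p * B p i + lincomb k (removeAt (insertAt a p 0#) p) (removeAt B p) i
      ≈⟨ +-cong (trans (*-congʳ (reflexive (insertAt-lookup a p 0#))) (zeroˡ _))
                (lincomb-cong k i (λ j → *-congʳ (reflexive (insertAt-punchIn a p 0# j)))) ⟩
    0# + lincomb k a (removeAt B p) i
      ≈⟨ +-identityˡ _ ⟩
    lincomb k a (removeAt B p) i
      ∎

  lincomb-[]≔ : ∀ k (a : Fin (suc k) → Carrier) (B : Fin (suc k) → V) p w i →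
                lincomb (suc k) a (B [ p ]≔ w) i ≈ a p * w i + lincomb k (removeAt a p) (removeAt B p) i
  lincomb-[]≔ k a B p w i = begin
    lincomb (suc k) a (B [ p ]≔ w) i
      ≈⟨ lincomb-removeAt k a (B [ p ]≔ w) p i ⟩
    a p * (B [ p ]≔ w) p i + lincomb k (removeAt a p) (removeAt (B [ p ]≔ w) p) i
      ≈⟨ +-cong (*-congˡ (reflexive (≡.cong-app ([]≔-updates B p) i)))
                (lincomb-cong k i λ j →
                  *-congˡ (reflexive (≡.cong-app ([]≔-minimal B (Fin.punchInᵢ≢i p j)) i))) ⟩
    a p * w i + lincomb k (removeAt a p) (removeAt B p) i
      ∎

  _⊆Span_ : ∀ {k m} → (Fin k → V) → (Fin m → V) → Set (c ⊔ ℓ)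
  B ⊆Span B′ = ∀ j → B j ∈Span B′

  _≈Span_ : ∀ {k m} → (Fin k → V) → (Fin m → V) → Set (c ⊔ ℓ)
  B ≈Span B′ = B ⊆Span B′ × B′ ⊆Span B

  module _ {k} (B : Fin k → V) where

    0ᵥ∈Span : 0ᵥ ∈Span B
    0ᵥ∈Span = const 0# , λ i → sym (lincomb-zero k i (λ j → zeroˡ (B j i)))

    ∈Span-+ : ∀ {u w} → u ∈Span B → w ∈Span B → (λ i → u i + w i) ∈Span B
    ∈Span-+ (a , u≈aB) (b , w≈bB) =
      (λ j → a j + b j) , λ i → trans (+-cong (u≈aB i) (w≈bB i)) (sym (lincomb-+ k a b B i))

    ∈Span-* : ∀ x {u} → u ∈Span B → (λ i → x * u i) ∈Span B
    ∈Span-* x (a , u≈aB) = (λ j → x * a j) , λ i → trans (*-congˡ (u≈aB i)) (sym (lincomb-* k x a B i))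

    ∈Span-resp : ∀ {u w} → u ≈ᵥ w → u ∈Span B → w ∈Span B
    ∈Span-resp u≈w (a , u≈aB) = a , λ i → trans (sym (u≈w i)) (u≈aB i)

    ∈Span-solve : ∀ {x u w r} → ¬ x ≈ 0# → u ∈Span B → r ∈Span B →
                  (∀ i → u i ≈ x * w i + r i) → w ∈Span B
    ∈Span-solve {x} x≉0 u∈B r∈B u≈xw+r with inverse x x≉0
    ... | y , xy≈1 = ∈Span-resp (λ i → sym (isolate xy≈1 (u≈xw+r i)))
                                (∈Span-* y (∈Span-+ u∈B (∈Span-* (- 1#) r∈B)))

    ∉Span⇒coefficient≈0 : ∀ {x u w r} → ¬ w ∈Span B → u ∈Span B → r ∈Span B →
                          (∀ i → u i ≈ x * w i + r i) → x ≈ 0#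
    ∉Span⇒coefficient≈0 {x} w∉B u∈B r∈B u≈xw+r with x ≟ 0#
    ... | yes x≈0 = x≈0
    ... | no x≉0  = ⊥-elim (w∉B (∈Span-solve x≉0 u∈B r∈B u≈xw+r))

  ∈Span-generator : ∀ {k} (B : Fin k → V) p → B p ∈Span B
  ∈Span-generator {suc k} B p = δ p , λ i → sym (lincomb-δ k B p i)

  lincomb-∈Span : ∀ {k m} {B : Fin k → V} (B′ : Fin m → V) →
                  B ⊆Span B′ → ∀ a → lincomb k a B ∈Span B′
  lincomb-∈Span {zero}  B′ B⊆B′ a = 0ᵥ∈Span B′
  lincomb-∈Span {suc k} B′ B⊆B′ a =
    ∈Span-+ B′ (∈Span-* B′ (a zero) (B⊆B′ zero)) (lincomb-∈Span B′ (B⊆B′ ∘ suc) (a ∘ suc))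

  ∈Span-⊆ : ∀ {k m} {B : Fin k → V} (B′ : Fin m → V) →
            B ⊆Span B′ → ∀ {v} → v ∈Span B → v ∈Span B′
  ∈Span-⊆ B′ B⊆B′ (a , v≈aB) = ∈Span-resp B′ (λ i → sym (v≈aB i)) (lincomb-∈Span B′ B⊆B′ a)

  ≈Span-refl : ∀ {k} {B : Fin k → V} → B ≈Span B
  ≈Span-refl {B = B} = ∈Span-generator B , ∈Span-generator B

  ≈Span-sym : ∀ {k m} {B : Fin k → V} {B′ : Fin m → V} → B ≈Span B′ → B′ ≈Span B
  ≈Span-sym (B⊆B′ , B′⊆B) = B′⊆B , B⊆B′

  ≈Span-trans : ∀ {k m r} {B : Fin k → V} {B′ : Fin m → V} {B″ : Fin r → V} →
                B ≈Span B′ → B′ ≈Span B″ → B ≈Span B″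
  ≈Span-trans {B = B} {B″ = B″} (B⊆B′ , B′⊆B) (B′⊆B″ , B″⊆B′) =
    ∈Span-⊆ B″ B′⊆B″ ∘ B⊆B′ , ∈Span-⊆ B B′⊆B ∘ B″⊆B′

  ≗⇒≈Span : ∀ {k} {B B′ : Fin k → V} → B ≗ B′ → B ≈Span B′
  ≗⇒≈Span {B = B} {B′} B≗B′ =
    (λ j → ≡.subst (_∈Span B′) (≡.sym (B≗B′ j)) (∈Span-generator B′ j)) ,
    (λ j → ≡.subst (_∈Span B) (B≗B′ j) (∈Span-generator B j))

  removeAt-⊆Span : ∀ {k} (B : Fin (suc k) → V) p → removeAt B p ⊆Span B
  removeAt-⊆Span B p j = ∈Span-generator B (punchIn p j)

  ∈Span-[]≔ : ∀ {k} (B : Fin k → V) {p j w} → j ≢ p → B j ∈Span (B [ p ]≔ w)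
  ∈Span-[]≔ B {p} {j} {w} j≢p =
    ≡.subst (_∈Span (B [ p ]≔ w)) ([]≔-minimal B j≢p) (∈Span-generator (B [ p ]≔ w) j)

  removeAt-⊆Span-[]≔ : ∀ {k} (B : Fin (suc k) → V) p {w} → removeAt B p ⊆Span (B [ p ]≔ w)
  removeAt-⊆Span-[]≔ B p j = ∈Span-[]≔ B (Fin.punchInᵢ≢i p j)

  -- Decided by trying each of the q values of the first coefficient.
  ∈Span? : ∀ {k} (B : Fin k → V) v → Dec (v ∈Span B)
  ∈Span? {zero} B v with Fin.all? (λ i → v i ≟ 0#)
  ... | yes v≈0 = yes ((λ ()) , v≈0)
  ... | no v≉0  = no (v≉0 ∘ proj₂)
  ∈Span? {suc k} B v with Fin.any? (λ x → ∈Span? (B ∘ suc) (λ i → v i + - (enum x * B zero i)))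
  ... | yes (x , a , v-xB₀≈aB) = yes (enum x ∷ a , λ i → x-y≈z⇒x≈y+z (v-xB₀≈aB i))
  ... | no ∄x = no (∄x ∘ first-coefficient)
    where
    first-coefficient : v ∈Span B → ∃ λ x → (λ i → v i + - (enum x * B zero i)) ∈Span (B ∘ suc)
    first-coefficient (a , v≈aB) with enum-sur (a zero)
    ... | x , x≈a₀ = x , a ∘ suc , λ i →
      trans (+-congˡ (-‿cong (*-congʳ x≈a₀))) (x≈y+z⇒x-y≈z (v≈aB i))

  lincomb-injective : ∀ {k} {B : Fin k → V} → LinIndep B → ∀ {a b} →
                      (∀ i → lincomb k a B i ≈ lincomb k b B i) → ∀ j → a j ≈ b j
  lincomb-injective {k} {B} B-indep {a} {b} aB≈bB j =
    x∙y⁻¹≈ε⇒x≈y (a j) (b j) (trans (+-congˡ (sym (-1*x≈-x (b j)))) (B-indep a-b a-b·B≈0 j))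
    where
    a-b : Fin k → Carrier
    a-b j = a j + - 1# * b j
    a-b·B≈0 : lincomb k a-b B ≈ᵥ 0ᵥ
    a-b·B≈0 i = begin
      lincomb k a-b B i                                   ≈⟨ lincomb-+ k a _ B i ⟩
      lincomb k a B i + lincomb k (λ j → - 1# * b j) B i  ≈⟨ +-congˡ (lincomb-* k (- 1#) b B i) ⟩
      lincomb k a B i + - 1# * lincomb k b B i            ≈⟨ +-congˡ (-1*x≈-x _) ⟩
      lincomb k a B i + - lincomb k b B i                 ≈⟨ x≈y⇒x∙y⁻¹≈ε (aB≈bB i) ⟩
      0#                                                  ∎

  lincomb-self-coefficient : ∀ {k} {B : Fin (suc k) → V} → LinIndep B → ∀ {p β} →
                             B p ≈ᵥ lincomb (suc k) β B → β p ≈ 1#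
  lincomb-self-coefficient {k} {B} B-indep {p} {β} Bₚ≈βB = begin
    β p    ≈⟨ lincomb-injective {B = B} B-indep {β} {δ p} βB≈δB p ⟩
    δ p p  ≡⟨ δ-diagonal p ⟩
    1#     ∎
    where
    βB≈δB : ∀ i → lincomb (suc k) β B i ≈ lincomb (suc k) (δ p) B i
    βB≈δB i = trans (sym (Bₚ≈βB i)) (sym (lincomb-δ k B p i))

  removeAt-indep : ∀ {k} {B : Fin (suc k) → V} → LinIndep B → ∀ p → LinIndep (removeAt B p)
  removeAt-indep {k} {B} B-indep p a aB≈0 j = begin
    a j                            ≡⟨ insertAt-punchIn a p 0# j ⟨
    insertAt a p 0# (punchIn p j)  ≈⟨ B-indep (insertAt a p 0#) aᵖB≈0 (punchIn p j) ⟩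
    0#                             ∎
    where
    aᵖB≈0 : lincomb (suc k) (insertAt a p 0#) B ≈ᵥ 0ᵥ
    aᵖB≈0 i = trans (lincomb-insertAt k a B p i) (aB≈0 i)

  []≔-indep : ∀ {k} {B : Fin (suc k) → V} {p w} →
              LinIndep B → ¬ w ∈Span removeAt B p → LinIndep (B [ p ]≔ w)
  []≔-indep {k} {B} {p} {w} B-indep w∉B∖p a aB′≈0 = B-indep a aB≈0
    where
    R : V
    R = lincomb k (removeAt a p) (removeAt B p)
    aₚ≈0 : a p ≈ 0#
    aₚ≈0 = ∉Span⇒coefficient≈0 (removeAt B p) w∉B∖p (0ᵥ∈Span _) (removeAt a p , λ _ → refl)
             (λ i → trans (sym (aB′≈0 i)) (lincomb-[]≔ k a B p w i))
    aₚ*≈0 : ∀ x → a p * x ≈ 0#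
    aₚ*≈0 x = trans (*-congʳ aₚ≈0) (zeroˡ x)
    aB≈0 : lincomb (suc k) a B ≈ᵥ 0ᵥ
    aB≈0 i = begin
      lincomb (suc k) a B i             ≈⟨ lincomb-removeAt k a B p i ⟩
      a p * B p i + R i                 ≈⟨ +-congʳ (trans (aₚ*≈0 (B p i)) (sym (aₚ*≈0 (w i)))) ⟩
      a p * w i + R i                   ≈⟨ lincomb-[]≔ k a B p w i ⟨
      lincomb (suc k) a (B [ p ]≔ w) i  ≈⟨ aB′≈0 i ⟩
      0#                                ∎

  module _ {k} {B : Fin (suc k) → V} {p : Fin (suc k)} (B-indep : LinIndep B) where

    exchange-indep : ∀ {v β} → v ≈ᵥ lincomb (suc k) β B → ¬ β p ≈ 0# → LinIndep (B [ p ]≔ v)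
    exchange-indep {v} {β} v≈βB βₚ≉0 = []≔-indep {B = B} {p} {v} B-indep λ (a , v≈aB∖p) →
      let βB≈aᵖB : ∀ i → lincomb (suc k) β B i ≈ lincomb (suc k) (insertAt a p 0#) B i
          βB≈aᵖB i = trans (sym (v≈βB i)) (trans (v≈aB∖p i) (sym (lincomb-insertAt k a B p i)))
      in βₚ≉0 (trans (lincomb-injective {B = B} B-indep {β} {insertAt a p 0#} βB≈aᵖB p)
                     (reflexive (insertAt-lookup a p 0#)))

    exchange-≈Span : ∀ {v β} → v ≈ᵥ lincomb (suc k) β B → ¬ β p ≈ 0# → B ≈Span (B [ p ]≔ v)
    exchange-≈Span {v} {β} v≈βB βₚ≉0 = B⊆B′ , B′⊆B
      where
      v∈B′ : v ∈Span (B [ p ]≔ v)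
      v∈B′ = ≡.subst (_∈Span (B [ p ]≔ v)) ([]≔-updates B p) (∈Span-generator (B [ p ]≔ v) p)
      B⊆B′ : B ⊆Span (B [ p ]≔ v)
      B⊆B′ j with j Fin.≟ p
      ... | yes ≡.refl = ∈Span-solve (B [ p ]≔ v) βₚ≉0 v∈B′
                           (lincomb-∈Span (B [ p ]≔ v) (removeAt-⊆Span-[]≔ B p) (removeAt β p))
                           (λ i → trans (v≈βB i) (lincomb-removeAt k β B p i))
      ... | no j≢p     = ∈Span-[]≔ B j≢p
      B′⊆B : (B [ p ]≔ v) ⊆Span B
      B′⊆B j with j Fin.≟ p
      ... | yes ≡.refl = ≡.subst (_∈Span B) (≡.sym ([]≔-updates B p)) (β , v≈βB)
      ... | no j≢p     = ≡.subst (_∈Span B) (≡.sym ([]≔-minimal B j≢p)) (∈Span-generator B j)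

    module _ {w} (w∉B : ¬ w ∈Span B) where

      replace-indep : LinIndep (B [ p ]≔ w)
      replace-indep = []≔-indep {B = B} {p} {w} B-indep (w∉B ∘ ∈Span-⊆ B (removeAt-⊆Span B p))

      replace-meet : HasDim k (λ v → v ∈Span B × v ∈Span (B [ p ]≔ w))
      replace-meet =
        removeAt B p ,
        (λ j → removeAt-⊆Span B p j , removeAt-⊆Span-[]≔ B p j) ,
        removeAt-indep {B = B} B-indep p ,
        meet⊆B∖p
        where
        meet⊆B∖p : ∀ v → v ∈Span B × v ∈Span (B [ p ]≔ w) → v ∈Span removeAt B p
        meet⊆B∖p v (v∈B , b , v≈bB′) = removeAt b p , λ i → begin
          v i         ≈⟨ v≈bₚw+R i ⟩
          b p * w i + R i  ≈⟨ +-congʳ (trans (*-congʳ bₚ≈0) (zeroˡ (w i))) ⟩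
          0# + R i    ≈⟨ +-identityˡ _ ⟩
          R i         ∎
          where
          R : V
          R = lincomb k (removeAt b p) (removeAt B p)
          v≈bₚw+R : ∀ i → v i ≈ b p * w i + R i
          v≈bₚw+R i = trans (v≈bB′ i) (lincomb-[]≔ k b B p w i)
          bₚ≈0 : b p ≈ 0#
          bₚ≈0 = ∉Span⇒coefficient≈0 B w∉B v∈B
                   (lincomb-∈Span B (removeAt-⊆Span B p) (removeAt b p)) v≈bₚw+R

  module _ {k} {B : Fin k → V} (π : Permutation′ k) where

    permute-indep : LinIndep B → LinIndep (B ∘ (π ⟨$⟩ʳ_))
    permute-indep B-indep a aBπ≈0 j = begin
      a j                    ≡⟨ ≡.cong a (Perm.inverseˡ π) ⟨
      a (π ⟨$⟩ˡ (π ⟨$⟩ʳ j))  ≈⟨ B-indep (a ∘ (π ⟨$⟩ˡ_)) aπ⁻¹B≈0 (π ⟨$⟩ʳ j) ⟩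
      0#                     ∎
      where
      aπ⁻¹B≈0 : lincomb k (a ∘ (π ⟨$⟩ˡ_)) B ≈ᵥ 0ᵥ
      aπ⁻¹B≈0 i = trans (sym (lincomb-permute k a B π i)) (aBπ≈0 i)

    permute-≈Span : B ≈Span (B ∘ (π ⟨$⟩ʳ_))
    permute-≈Span =
      (λ j → ≡.subst (_∈Span Bπ) (≡.cong B (Perm.inverseʳ π)) (∈Span-generator Bπ (π ⟨$⟩ˡ j))) ,
      (λ j → ∈Span-generator B (π ⟨$⟩ʳ j))
      where
      Bπ : Fin k → V
      Bπ = B ∘ (π ⟨$⟩ʳ_)

  _~_ : ∀ {k} → Code n k → Code n k → Set (c ⊔ ℓ)
  X ~ Y = Adjacent (space X) (space Y)

  HasDim-resp : ∀ {d} {P Q : V → Set (c ⊔ ℓ)} →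
                (∀ {v} → P v → Q v) → (∀ {v} → Q v → P v) → HasDim d P → HasDim d Q
  HasDim-resp P⇒Q Q⇒P (D , D∈P , D-indep , P⊆D) = D , P⇒Q ∘ D∈P , D-indep , λ v → P⊆D v ∘ Q⇒P

  ~-sym : ∀ {k} {X Y : Code n k} → X ~ Y → Y ~ X
  ~-sym = HasDim-resp (λ (x , y) → y , x) (λ (y , x) → x , y)

  meet-resp-≈Span : ∀ {d k l m} {B : Fin k → V} {B′ : Fin l → V} (B″ : Fin m → V) → B ≈Span B′ →
                    HasDim d (λ v → v ∈Span B × v ∈Span B″) →
                    HasDim d (λ v → v ∈Span B′ × v ∈Span B″)
  meet-resp-≈Span {B = B} {B′} B″ (B⊆B′ , B′⊆B) =
    HasDim-resp (λ (v∈B , v∈B″) → ∈Span-⊆ B′ B⊆B′ v∈B , v∈B″)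
                (λ (v∈B′ , v∈B″) → ∈Span-⊆ B B′⊆B v∈B′ , v∈B″)

  codeOf : ∀ {k} (B : Fin (suc k) → V) → LinIndep B → (∀ i → ¬ B zero i ≈ 0#) → Code n (suc k)
  codeOf B B-indep B₀≉0 = record
    { space  = record { basis = B ; indep = B-indep }
    ; nondeg = λ i ⊆Cᵢ → B₀≉0 i (⊆Cᵢ (B zero) (∈Span-generator B zero))
    }

  module SteinitzWalk {k} (T : Fin (suc k) → V) (T-indep : LinIndep T) (T₀≉0 : ∀ i → ¬ T zero i ≈ 0#)
                      (C : Code n (suc k)) where

    AgreesBelow : ℕ → (Fin (suc k) → V) → Set c
    AgreesBelow m B = ∀ i → toℕ i < m → B i ≡ T i

    record Stage (m : ℕ) : Set (c ⊔ ℓ) where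
      field
        X       : Code n (suc k)
        C⇝X     : Star _~_ C X
        B       : Fin (suc k) → V
        B-indep : LinIndep B
        X≈B     : basis (space X) ≈Span B
        B≡T     : AgreesBelow m B

    agrees-step : ∀ {B B′} j → AgreesBelow (toℕ j) B → B′ j ≡ T j →
                  (∀ i → toℕ i < toℕ j → B′ i ≡ B i) → AgreesBelow (suc (toℕ j)) B′
    agrees-step j B≡T B′ⱼ≡Tⱼ B′≡B i i≤j with toℕ i ℕ.<? toℕ j
    ... | yes i<j = ≡.trans (B′≡B i i<j) (B≡T i i<j)
    ... | no i≮j rewrite Fin.toℕ-injective (ℕ.≤-antisym (ℕ.s≤s⁻¹ i≤j) (ℕ.≮⇒≥ i≮j)) = B′ⱼ≡Tⱼ

    below⇒≢ : ∀ {i j l : Fin (suc k)} → toℕ i < toℕ j → toℕ j ≤ toℕ l → i ≢ l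
    below⇒≢ i<j j≤l ≡.refl = ℕ.<-irrefl ≡.refl (ℕ.<-≤-trans i<j j≤l)

    -- Otherwise T j would be a combination of the T l with l < j.
    pivot : ∀ {B β} j → AgreesBelow (toℕ j) B → T j ≈ᵥ lincomb (suc k) β B →
            ∃ λ l → toℕ j ≤ toℕ l × ¬ β l ≈ 0#
    pivot {B} {β} j B≡T Tⱼ≈βB with Fin.any? (λ l → (toℕ j ℕ.≤? toℕ l) ×-dec ¬? (β l ≟ 0#))
    ... | yes found = found
    ... | no none   =
      ⊥-elim (0≉1 (trans (sym (βₗ≈0 j ℕ.≤-refl))
                         (lincomb-self-coefficient {B = T} T-indep {β = β} Tⱼ≈βT)))
      where
      βₗ≈0 : ∀ l → toℕ j ≤ toℕ l → β l ≈ 0#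
      βₗ≈0 l j≤l with β l ≟ 0#
      ... | yes βₗ≈0 = βₗ≈0
      ... | no βₗ≉0  = ⊥-elim (none (l , j≤l , βₗ≉0))
      same-terms : ∀ i l → β l * B l i ≈ β l * T l i
      same-terms i l with toℕ l ℕ.<? toℕ j
      ... | yes l<j = *-congˡ (reflexive (≡.cong-app (B≡T l l<j) i))
      ... | no l≮j  = trans (βₗ*≈0 (B l i)) (sym (βₗ*≈0 (T l i)))
        where
        βₗ*≈0 : ∀ x → β l * x ≈ 0#
        βₗ*≈0 x = trans (*-congʳ (βₗ≈0 l (ℕ.≮⇒≥ l≮j))) (zeroˡ x)
      Tⱼ≈βT : T j ≈ᵥ lincomb (suc k) β T
      Tⱼ≈βT i = trans (Tⱼ≈βB i) (lincomb-cong (suc k) {B = B} {B′ = T} i (same-terms i))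

    replaceStep : ∀ j (S : Stage (toℕ j)) → ¬ T j ∈Span Stage.B S → Stage (suc (toℕ j))
    replaceStep j S Tⱼ∉B = record
      { X = X′ ; C⇝X = C⇝X ◅◅ (X~X′ ◅ ε) ; B = B′ ; B-indep = B′-indep
      ; X≈B = ≈Span-refl ; B≡T = B′≡T
      }
      where
      open Stage S
      B′ : Fin (suc k) → V
      B′ = B [ j ]≔ T j
      B′-indep : LinIndep B′
      B′-indep = replace-indep {B = B} {p = j} B-indep Tⱼ∉B
      B′≡T : AgreesBelow (suc (toℕ j)) B′
      B′≡T = agrees-step j B≡T ([]≔-updates B j) (λ i i<j → []≔-minimal B (below⇒≢ i<j ℕ.≤-refl))
      X′ : Code n (suc k)
      X′ = codeOf B′ B′-indep
             (≡.subst (λ v → ∀ i → ¬ v i ≈ 0#) (≡.sym (B′≡T zero (s≤s z≤n))) T₀≉0)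
      X~X′ : X ~ X′
      X~X′ = meet-resp-≈Span B′ (≈Span-sym X≈B) (replace-meet {B = B} {p = j} B-indep Tⱼ∉B)

    reorderStep : ∀ j (S : Stage (toℕ j)) → T j ∈Span Stage.B S → Stage (suc (toℕ j))
    reorderStep j S (β , Tⱼ≈βB) with pivot {β = β} j (Stage.B≡T S) Tⱼ≈βB
    ... | l , j≤l , βₗ≉0 = record
      { X       = X
      ; C⇝X     = C⇝X
      ; B       = B″
      ; B-indep = permute-indep {B = B′} π (exchange-indep {B = B} {p = l} B-indep {β = β} Tⱼ≈βB βₗ≉0)
      ; X≈B     = ≈Span-trans X≈B
                    (≈Span-trans (exchange-≈Span {B = B} {p = l} B-indep {β = β} Tⱼ≈βB βₗ≉0)
                                 (permute-≈Span {B = B′} π))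
      ; B≡T     = agrees-step j B≡T B″ⱼ≡Tⱼ B″≡B
      }
      where
      open Stage S
      π : Permutation′ (suc k)
      π = Perm.transpose j l
      B′ B″ : Fin (suc k) → V
      B′ = B [ l ]≔ T j
      B″ = B′ ∘ (π ⟨$⟩ʳ_)
      B″ⱼ≡Tⱼ : B″ j ≡ T j
      B″ⱼ≡Tⱼ = ≡.trans (≡.cong B′ (transpose-matchˡ j l)) ([]≔-updates B l)
      B″≡B : ∀ i → toℕ i < toℕ j → B″ i ≡ B i
      B″≡B i i<j = ≡.trans (≡.cong B′ (transpose-fixes (below⇒≢ i<j ℕ.≤-refl) (below⇒≢ i<j j≤l)))
                           ([]≔-minimal B (below⇒≢ i<j j≤l))

    extend : ∀ {m} (j : Fin (suc k)) → toℕ j ≡ m → Stage m → Stage (suc m)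
    extend j ≡.refl S with ∈Span? (Stage.B S) (T j)
    ... | yes Tⱼ∈B = reorderStep j S Tⱼ∈B
    ... | no Tⱼ∉B  = replaceStep j S Tⱼ∉B

    stage : ∀ m → m ≤ suc k → Stage m
    stage zero    _   = record
      { X = C ; C⇝X = ε ; B = basis (space C) ; B-indep = indep (space C) ; X≈B = ≈Span-refl ; B≡T = λ _ () }
    stage (suc m) m<k = extend (fromℕ< m<k) (Fin.toℕ-fromℕ< m<k) (stage m (ℕ.<⇒≤ m<k))

    reaches-span : Σ (Code n (suc k)) λ X → Star _~_ C X × basis (space X) ≈Span T
    reaches-span = X , C⇝X , ≈Span-trans X≈B (≗⇒≈Span (λ j → B≡T j (Fin.toℕ<n j)))
      where open Stage (stage (suc k) ℕ.≤-refl)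

  module Hub {K} (g : Fin (suc K) → Fin n) (g-injective : ∀ {i j} → g i ≡ g j → i ≡ j)
             {c₀ c₁ : Fin n} (c₁≢c₀ : c₁ ≢ c₀)
             (c₀∉g : ∀ i → c₀ ≢ g i) (c₁∉g : ∀ i → c₁ ≢ g i) where

    T : Fin (suc (suc K)) → V
    T = const 1# ∷ (δ ∘ g)

    T-outside : ∀ a {x} → (∀ i → x ≢ g i) → lincomb (suc (suc K)) a T x ≈ a zero
    T-outside a {x} x∉g = begin
      a zero * 1# + lincomb (suc K) (a ∘ suc) (δ ∘ g) x
        ≈⟨ +-congˡ (lincomb-zero (suc K) {B = δ ∘ g} x units≈0) ⟩
      a zero * 1# + 0#
        ≈⟨ +-identityʳ _ ⟩
      a zero * 1#
        ≈⟨ *-identityʳ _ ⟩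
      a zero
        ∎
      where
      units≈0 : ∀ j → a (suc j) * δ (g j) x ≈ 0#
      units≈0 j = trans (*-congˡ (reflexive (δ-offDiagonal (x∉g j)))) (zeroʳ _)

    units-at : ∀ a i → lincomb (suc K) a (δ ∘ g) (g i) ≈ a i
    units-at a i = begin
      lincomb (suc K) a (δ ∘ g) (g i)
        ≈⟨ lincomb-removeAt K a (δ ∘ g) i (g i) ⟩
      a i * δ (g i) (g i) + lincomb K (removeAt a i) (removeAt (δ ∘ g) i) (g i)
        ≈⟨ +-cong (*-congˡ (reflexive (δ-diagonal (g i))))
                  (lincomb-zero K {B = removeAt (δ ∘ g) i} (g i) others≈0) ⟩
      a i * 1# + 0#
        ≈⟨ +-identityʳ _ ⟩
      a i * 1#
        ≈⟨ *-identityʳ _ ⟩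
      a i
        ∎
      where
      others≈0 : ∀ j → a (punchIn i j) * δ (g (punchIn i j)) (g i) ≈ 0#
      others≈0 j = trans (*-congˡ (reflexive (δ-offDiagonal (Fin.punchInᵢ≢i i j ∘ ≡.sym ∘ g-injective))))
                         (zeroʳ _)

    T-indep : LinIndep T
    T-indep a aT≈0 = a≈0
      where
      a₀≈0 : a zero ≈ 0#
      a₀≈0 = trans (sym (T-outside a c₁∉g)) (aT≈0 c₁)
      a≈0 : ∀ j → a j ≈ 0#
      a≈0 zero    = a₀≈0
      a≈0 (suc i) = begin
        a (suc i)
          ≈⟨ +-identityˡ _ ⟨
        0# + a (suc i)
          ≈⟨ +-cong (trans (*-congʳ a₀≈0) (zeroˡ 1#)) (units-at (a ∘ suc) i) ⟨
        a zero * 1# + lincomb (suc K) (a ∘ suc) (δ ∘ g) (g i)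
          ≈⟨ aT≈0 (g i) ⟩
        0#
          ∎

    e₀∉T : ¬ δ c₀ ∈Span T
    e₀∉T (a , e₀≈aT) = 1≉0 (begin
      1#                            ≡⟨ δ-diagonal c₀ ⟨
      δ c₀ c₀                       ≈⟨ e₀≈aT c₀ ⟩
      lincomb (suc (suc K)) a T c₀  ≈⟨ T-outside a c₀∉g ⟩
      a zero                        ≈⟨ T-outside a c₁∉g ⟨
      lincomb (suc (suc K)) a T c₁  ≈⟨ e₀≈aT c₁ ⟨
      δ c₀ c₁                       ≡⟨ δ-offDiagonal c₁≢c₀ ⟩
      0#                            ∎)

    H : Code n (suc (suc K))
    H = codeOf T T-indep (λ _ → 1≉0)

    N : Code n (suc (suc K))
    N = codeOf (T [ suc zero ]≔ δ c₀) (replace-indep {B = T} {p = suc zero} T-indep e₀∉T) (λ _ → 1≉0)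

    H~N : H ~ N
    H~N = replace-meet {B = T} {p = suc zero} T-indep e₀∉T

    toHub : ∀ C → Star _~_ C H
    toHub C =
      let X , C⇝X , X≈T = SteinitzWalk.reaches-span T T-indep (λ _ → 1≉0) C
          X~N : X ~ N
          X~N = meet-resp-≈Span (basis (space N)) (≈Span-sym X≈T) H~N
      in C⇝X ◅◅ _◅_ {j = N} X~N (~-sym {X = H} {N} H~N ◅ ε)

    connected : ∀ C D → Star _~_ C D
    connected C D = toHub C ◅◅ reverse (λ {X} {Y} → ~-sym {X = X} {Y}) (toHub D)

Γ-connected : ∀ {c ℓ q} (F : FiniteField c ℓ q) {n k} → 1 < k → k < n →
              let open Linear F in (C D : Code n k) → Star (LinearAlgebra._~_ F) C D
Γ-connected F {suc (suc (suc n₀))} {suc (suc K)} (s≤s (s≤s z≤n)) (s≤s (s≤s (s≤s K≤n₀))) =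
  Hub.connected g g-injective {zero} {suc zero} (λ ()) (λ _ ()) (λ _ ())
  where
  open LinearAlgebra F
  g : Fin (suc K) → Fin (suc (suc (suc n₀)))
  g i = suc (suc (inject≤ i (s≤s K≤n₀)))
  g-injective : ∀ {i j} → g i ≡ g j → i ≡ j
  g-injective {i} {j} = Fin.inject≤-injective _ _ i j ∘ Fin.suc-injective ∘ Fin.suc-injective

proposition1 : ∀ {c ℓ : Level} (q : ℕ) (F : FiniteField c ℓ q) → IsPrimePower q →
    (n k : ℕ) → 1 < k → k < n ∸ 1 →
    let open Linear F in
    (C D : Code n k) →
    Σ ℕ λ m → Σ (Fin (suc m) → Code n k) λ P →
      (P zero ≡ C) × (P (fromℕ m) ≡ D) ×
      (∀ (i : Fin m) → Adjacent (space (P (inject₁ i))) (space (P (suc i))))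
proposition1 q F _ n k 1<k k<n∸1 C D =
  fromStar (Γ-connected F 1<k (ℕ.<-≤-trans k<n∸1 (ℕ.m∸n≤m n 1)) C D)
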